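{- Let $n>1$ be an integer and let $p$ be an odd prime such that $p>\operatorname{rad}(n)$. Then for each positive integer $k$, $(1,n^{p(p-1)k}-1,n^{p(p-1)k})$ is an $abc$ triple.
   Context: For a positive integer $n$, $\operatorname{rad}(n)$ denotes the product of the distinct prime factors of $n$. An $abc$ triple is a triple $(a,b,c)$ of relatively prime positive integers with $a+b=c$ and $\operatorname{rad}(abc)<c$. -}

module Defs where

open import Data.Nat using (ℕ; suc; _+_; _*_; _<_)
open import Data.Nat.Primality using (Prime; prime?)
open import Data.Nat.Divisibility using (_∣_; _∣?_)
open import Data.Nat.Coprimality using (Coprime)
open import Data.List using (List; filter; upTo; map)
open import Data.Nat.ListAction using (product)
open import Data.Product using (_×_)
open import Relation.Nullary.Decidable using (_×-dec_)
open import Relation.Binary.PropositionalEquality using (_≡_)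

-- The prime divisors of n, listed without repetition: all d ∈ {1,…,n}
-- with d prime and d ∣ n.  (For n = 0 this list is empty.)
primeDivisors : ℕ → List ℕ
primeDivisors n = filter (λ d → prime? d ×-dec (d ∣? n)) (map suc (upTo n))

rad : ℕ → ℕ
rad n = product (primeDivisors n)

record ABCTriple (a b c : ℕ) : Set where
  field
    a-pos    : 0 < a
    b-pos    : 0 < b
    c-pos    : 0 < c
    coprime-ab : Coprime a b
    coprime-ac : Coprime a c
    coprime-bc : Coprime b c
    sum      : a + b ≡ c
    rad<c    : rad (a * b * c) < c

-- Since rad n < p, the prime p does not divide n, so Fermat's little theorem gives
-- n ^ (p - 1) ≡ 1 (mod p); raising any x ≡ 1 (mod p) to the p-th power yields x ^ p ≡ 1 (mod p²).
-- Hence c = n ^ (p (p - 1) k) = 1 + w p² with w ≥ 1. Every prime factor of (c - 1) c divides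
-- either c, hence rad c ∣ rad n, or w p, so rad((c - 1) c) ≤ rad n · w p < w p² = c - 1.

module Submission where

open import Data.Empty using (⊥-elim)
open import Data.List using (List; _∷_; map; upTo)
open import Data.List.Membership.Propositional using (_∈_)
open import Data.List.Membership.Propositional.Properties using (∈-filter⁺; ∈-filter⁻; ∈-map⁺; ∈-upTo⁺)
open import Data.List.Relation.Unary.All as All using (All; []; _∷_)
open import Data.List.Relation.Unary.AllPairs using ([]; _∷_)
open import Data.List.Relation.Unary.Unique.Propositional using (Unique)
import Data.List.Relation.Unary.Unique.Propositional.Properties as Unique
open import Data.Nat
open import Data.Nat.Combinatorics using (_C_; nCk+nC[k+1]≡[n+1]C[k+1]; nCn≡1; k![n∸k]!∣n!)
open import Data.Nat.Combinatorics.Specification using (nCk≡n!/k![n-k]!; k>n⇒nCk≡0)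
open import Data.Nat.Coprimality using (Coprime; coprime-divisor; 1-coprimeTo)
open import Data.Nat.DivMod using (m/n*n≡m)
open import Data.Nat.Divisibility
open import Data.Nat.ListAction using (product)
open import Data.Nat.ListAction.Properties using (∈⇒∣product)
open import Data.Nat.Primality
open import Data.Nat.Properties
open import Data.Nat.Tactic.RingSolver using (solve-∀)
open import Data.Product using (∃-syntax; _×_; _,_; proj₁; proj₂)
open import Data.Sum using (inj₁; inj₂)
open import Function using (_∘_)
open import Relation.Binary.PropositionalEquality
open import Relation.Nullary.Decidable using (_×-dec_)

open import Defs

private
  variable
    c d k m n p q x x′ y y′ z : ℕ
    ps : List ℕ

infix 4 _≡_[mod_]

-- One-sided congruence: a witness also shows y ≤ x, so no truncated subtraction occurs.
_≡_[mod_] : ℕ → ℕ → ℕ → Set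
x ≡ y [mod m ] = ∃[ t ] x ≡ y + t * m

≡[mod]-refl : x ≡ x [mod m ]
≡[mod]-refl {x} = 0 , sym (+-identityʳ x)

≡⇒≡[mod] : x ≡ y → x ≡ y [mod m ]
≡⇒≡[mod] refl = ≡[mod]-refl

∣⇒≡0[mod] : m ∣ x → x ≡ 0 [mod m ]
∣⇒≡0[mod] (divides t x≡t*m) = t , x≡t*m

≡[mod]-trans : x ≡ y [mod m ] → y ≡ z [mod m ] → x ≡ z [mod m ]
≡[mod]-trans {m = m} {z = z} (s , refl) (t , refl) =
  t + s , trans (+-assoc z (t * m) (s * m)) (cong (z +_) (sym (*-distribʳ-+ m t s)))

≡[mod]-+ : x ≡ x′ [mod m ] → y ≡ y′ [mod m ] → x + y ≡ x′ + y′ [mod m ]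
≡[mod]-+ {x′ = x′} {m} {y′ = y′} (s , refl) (t , refl) = s + t , expand x′ y′ s t m
  where
  expand : ∀ x y s t m → x + s * m + (y + t * m) ≡ x + y + (s + t) * m
  expand = solve-∀

≡[mod]-* : x ≡ x′ [mod m ] → y ≡ y′ [mod m ] → x * y ≡ x′ * y′ [mod m ]
≡[mod]-* {x′ = x′} {m} {y′ = y′} (s , refl) (t , refl) =
  x′ * t + s * y′ + s * t * m , expand x′ y′ s t m
  where
  expand : ∀ x y s t m → (x + s * m) * (y + t * m) ≡ x * y + (x * t + s * y + s * t * m) * m
  expand = solve-∀

≡1[mod]-^ : x ≡ 1 [mod m ] → ∀ k → x ^ k ≡ 1 [mod m ]
≡1[mod]-^ x≡1 zero    = ≡[mod]-refl
≡1[mod]-^ x≡1 (suc k) = ≡[mod]-* x≡1 (≡1[mod]-^ x≡1 k)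

geometricSum : ℕ → ℕ → ℕ
geometricSum x zero    = 0
geometricSum x (suc j) = 1 + x * geometricSum x j

[1+d]^j≡1+d*geometricSum : ∀ d j → (1 + d) ^ j ≡ 1 + d * geometricSum (1 + d) j
[1+d]^j≡1+d*geometricSum d zero    = cong suc (sym (*-zeroʳ d))
[1+d]^j≡1+d*geometricSum d (suc j) =
  trans (cong ((1 + d) *_) ([1+d]^j≡1+d*geometricSum d j)) (expand d (geometricSum (1 + d) j))
  where
  expand : ∀ d g → (1 + d) * (1 + d * g) ≡ 1 + d * (1 + (1 + d) * g)
  expand = solve-∀

geometricSum-≡[mod] : x ≡ 1 [mod m ] → ∀ j → geometricSum x j ≡ j [mod m ]
geometricSum-≡[mod] x≡1 zero    = ≡[mod]-refl
geometricSum-≡[mod] {x} {m} x≡1 (suc j) =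
  ≡[mod]-+ (≡[mod]-refl {1}) (subst (λ y → x * geometricSum x j ≡ y [mod m ]) (*-identityˡ j)
    (≡[mod]-* x≡1 (geometricSum-≡[mod] x≡1 j)))

≡1[mod]-^-lift : x ≡ 1 [mod m ] → x ^ m ≡ 1 [mod m * m ]
≡1[mod]-^-lift {m = m} x≡1@(s , refl) with geometricSum-≡[mod] x≡1 m
... | v , G≡m+vm = s * (1 + v) , (begin
  (1 + s * m) ^ m                           ≡⟨ [1+d]^j≡1+d*geometricSum (s * m) m ⟩
  1 + s * m * geometricSum (1 + s * m) m    ≡⟨ cong (λ g → 1 + s * m * g) G≡m+vm ⟩
  1 + s * m * (m + v * m)                   ≡⟨ expand s m v ⟩
  1 + s * (1 + v) * (m * m)                 ∎)
  where
  open ≡-Reasoning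
  expand : ∀ s m v → 1 + s * m * (m + v * m) ≡ 1 + s * (1 + v) * (m * m)
  expand = solve-∀

binomialSum : ℕ → ℕ → ℕ → ℕ
binomialSum m a zero    = 0
binomialSum m a (suc j) = binomialSum m a j + (m C j) * a ^ j

binomialSum-pascal : ∀ m a j → binomialSum (suc m) a (suc j) ≡ binomialSum m a (suc j) + a * binomialSum m a j
binomialSum-pascal m a zero    = cong (1 +_) (sym (*-zeroʳ a))
binomialSum-pascal m a (suc j) = begin
  binomialSum (suc m) a (suc j) + (suc m C suc j) * a ^ suc j
    ≡⟨ cong₂ _+_ (binomialSum-pascal m a j) (cong (_* a ^ suc j) (sym (nCk+nC[k+1]≡[n+1]C[k+1] m j))) ⟩
  (S₁ + a * S₀) + ((m C j) + (m C suc j)) * (a * a ^ j)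
    ≡⟨ regroup S₁ S₀ (m C j) (m C suc j) a (a ^ j) ⟩
  (S₁ + (m C suc j) * (a * a ^ j)) + a * (S₀ + (m C j) * a ^ j) ∎
  where
  open ≡-Reasoning
  S₀ S₁ : ℕ
  S₀ = binomialSum m a j
  S₁ = binomialSum m a (suc j)
  regroup : ∀ s₁ s₀ c₀ c₁ a x → (s₁ + a * s₀) + (c₀ + c₁) * (a * x) ≡ (s₁ + c₁ * (a * x)) + a * (s₀ + c₀ * x)
  regroup = solve-∀

[1+a]^m≡binomialSum : ∀ m a → suc a ^ m ≡ binomialSum m a (suc m)
[1+a]^m≡binomialSum zero    a = refl
[1+a]^m≡binomialSum (suc m) a = begin
  suc a * suc a ^ m                  ≡⟨ cong (suc a *_) ([1+a]^m≡binomialSum m a) ⟩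
  S + a * S                          ≡⟨ cong (_+ a * S) (sym vanishingTerm) ⟩
  binomialSum m a (2 + m) + a * S    ≡⟨ sym (binomialSum-pascal m a (suc m)) ⟩
  binomialSum (suc m) a (2 + m)      ∎
  where
  open ≡-Reasoning
  S : ℕ
  S = binomialSum m a (suc m)
  vanishingTerm : S + (m C suc m) * a ^ suc m ≡ S
  vanishingTerm = trans (cong (λ c → S + c * a ^ suc m) (k>n⇒nCk≡0 (n<1+n m))) (+-identityʳ S)

prime∤1 : Prime p → p ∤ 1
prime∤1 p-prime p∣1 = ¬prime[1] (subst Prime (∣1⇒≡1 p∣1) p-prime)

prime∤⇒coprime : Prime p → p ∤ n → Coprime p n
prime∤⇒coprime p-prime p∤n (d∣p , d∣n) with prime⇒irreducible p-prime d∣p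
... | inj₁ d≡1 = d≡1
... | inj₂ refl = ⊥-elim (p∤n d∣n)

prime∤* : Prime p → p ∤ m → p ∤ n → p ∤ m * n
prime∤* {m = m} {n} p-prime p∤m p∤n p∣mn with euclidsLemma m n p-prime p∣mn
... | inj₁ p∣m = p∤m p∣m
... | inj₂ p∣n = p∤n p∣n

prime∣prime⇒≡ : Prime q → Prime p → q ∣ p → q ≡ p
prime∣prime⇒≡ q-prime p-prime q∣p with prime⇒irreducible p-prime q∣p
... | inj₁ refl = ⊥-elim (¬prime[1] q-prime)
... | inj₂ q≡p = q≡p

prime∣^⇒∣ : Prime p → ∀ e → p ∣ m ^ e → p ∣ m
prime∣^⇒∣ p-prime zero    p∣1 = ⊥-elim (prime∤1 p-prime p∣1)
prime∣^⇒∣ {m = m} p-prime (suc e) p∣m^e+1 with euclidsLemma m (m ^ e) p-prime p∣m^e+1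
... | inj₁ p∣m   = p∣m
... | inj₂ p∣m^e = prime∣^⇒∣ p-prime e p∣m^e

prime∤m! : Prime p → m < p → p ∤ m !
prime∤m! {m = zero}  p-prime _   = prime∤1 p-prime
prime∤m! {m = suc m} p-prime m<p =
  prime∤* p-prime (λ p∣1+m → <⇒≱ m<p (∣⇒≤ p∣1+m)) (prime∤m! p-prime (<-trans (n<1+n m) m<p))

k![n∸k]!*nCk≡n! : k ≤ n → k ! * (n ∸ k) ! * (n C k) ≡ n !
k![n∸k]!*nCk≡n! {k} {n} k≤n = begin
  k ! * (n ∸ k) ! * (n C k)                      ≡⟨ *-comm (k ! * (n ∸ k) !) (n C k) ⟩
  (n C k) * (k ! * (n ∸ k) !)                    ≡⟨ cong (_* (k ! * (n ∸ k) !)) (nCk≡n!/k![n-k]! k≤n) ⟩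
  (n ! / (k ! * (n ∸ k) !)) * (k ! * (n ∸ k) !)  ≡⟨ m/n*n≡m (k![n∸k]!∣n! k≤n) ⟩
  n !                                            ∎
  where
  open ≡-Reasoning
  instance
    _ : NonZero (k ! * (n ∸ k) !)
    _ = k !* (n ∸ k) !≢0

prime∣pCk : Prime p → 0 < k → k < p → p ∣ p C k
prime∣pCk {p@(suc r)} {k} p-prime 0<k k<p = coprime-divisor (prime∤⇒coprime p-prime p∤k![p∸k]!) p∣k![p∸k]!*pCk
  where
  p∤k![p∸k]! : p ∤ k ! * (p ∸ k) !
  p∤k![p∸k]! = prime∤* p-prime (prime∤m! p-prime k<p) (prime∤m! p-prime (∸-monoʳ-< 0<k (<⇒≤ k<p)))
  p∣k![p∸k]!*pCk : p ∣ k ! * (p ∸ k) ! * (p C k)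
  p∣k![p∸k]!*pCk = subst (p ∣_) (sym (k![n∸k]!*nCk≡n! (<⇒≤ k<p))) (m∣m*n (r !))

binomialSum-≡1[mod] : Prime p → ∀ a j → j < p → binomialSum p a (suc j) ≡ 1 [mod p ]
binomialSum-≡1[mod] p-prime a zero    _     = ≡[mod]-refl
binomialSum-≡1[mod] p-prime a (suc j) 1+j<p =
  ≡[mod]-+ (binomialSum-≡1[mod] p-prime a j (<-trans (n<1+n j) 1+j<p))
           (∣⇒≡0[mod] (∣m⇒∣m*n _ (prime∣pCk p-prime z<s 1+j<p)))

[1+a]^p≡1+a^p[mod] : Prime p → ∀ a → suc a ^ p ≡ suc (a ^ p) [mod p ]
[1+a]^p≡1+a^p[mod] {p@(suc r)} p-prime a =
  ≡[mod]-trans (≡⇒≡[mod] ([1+a]^m≡binomialSum p a))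
    (≡[mod]-+ (binomialSum-≡1[mod] p-prime a r ≤-refl)
              (≡⇒≡[mod] (trans (cong (_* a ^ p) (nCn≡1 p)) (*-identityˡ (a ^ p)))))

fermat : Prime p → ∀ a → a ^ p ≡ a [mod p ]
fermat {suc r} p-prime zero    = ≡[mod]-refl
fermat         p-prime (suc a) =
  ≡[mod]-trans ([1+a]^p≡1+a^p[mod] p-prime a) (≡[mod]-+ (≡[mod]-refl {1}) (fermat p-prime a))

prime∤-cancel-≡1[mod] : Prime p → p ∤ n → n * x ≡ n [mod p ] → 0 < x → x ≡ 1 [mod p ]
prime∤-cancel-≡1[mod] {p} {n} {suc x} p-prime p∤n (t , n[1+x]≡n+tp) _ =
  let divides s x≡sp = coprime-divisor (prime∤⇒coprime p-prime p∤n) (divides t nx≡tp)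
  in  s , cong suc x≡sp
  where
  nx≡tp : n * x ≡ t * p
  nx≡tp = +-cancelˡ-≡ n _ _ (trans (sym (*-suc n x)) n[1+x]≡n+tp)

fermat-coprime : Prime p → p ∤ n → n ^ (p ∸ 1) ≡ 1 [mod p ]
fermat-coprime {n = zero}  p-prime p∤0 = ⊥-elim (p∤0 (_ ∣0))
fermat-coprime {suc r} {n@(suc _)} p-prime p∤n =
  prime∤-cancel-≡1[mod] p-prime p∤n (fermat p-prime n) (m^n>0 n r)

primeDivisors-unique : ∀ n → Unique (primeDivisors n)
primeDivisors-unique n =
  Unique.filter⁺ (λ d → prime? d ×-dec (d ∣? n)) (Unique.map⁺ suc-injective (Unique.upTo⁺ n))

∈primeDivisors⇒prime∣ : ∀ n → q ∈ primeDivisors n → Prime q × q ∣ n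
∈primeDivisors⇒prime∣ n q∈ =
  proj₂ (∈-filter⁻ (λ d → prime? d ×-dec (d ∣? n)) {xs = map suc (upTo n)} q∈)

prime∣⇒∈primeDivisors : .{{NonZero n}} → Prime q → q ∣ n → q ∈ primeDivisors n
prime∣⇒∈primeDivisors {n} {zero}  q-prime _   = ⊥-elim (¬prime[0] q-prime)
prime∣⇒∈primeDivisors {n} {suc q} q-prime q∣n =
  ∈-filter⁺ (λ d → prime? d ×-dec (d ∣? n)) (∈-map⁺ suc (∈-upTo⁺ (∣⇒≤ q∣n))) (q-prime , q∣n)

prime∤product : Prime p → All Prime ps → All (p ≢_) ps → p ∤ product ps
prime∤product p-prime []                    []            = prime∤1 p-prime
prime∤product p-prime (q-prime ∷ qs-prime) (p≢q ∷ p≢qs) =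
  prime∤* p-prime (p≢q ∘ prime∣prime⇒≡ p-prime q-prime) (prime∤product p-prime qs-prime p≢qs)

product-∣ : Unique ps → All Prime ps → All (_∣ d) ps → product ps ∣ d
product-∣ [] [] [] = 1∣ _
product-∣ {q ∷ qs} (q∉qs ∷ qs-unique) (q-prime ∷ qs-prime) (q∣d ∷ qs∣d)
  with product-∣ qs-unique qs-prime qs∣d
... | divides e d≡e*Π = subst (q * product qs ∣_) (sym d≡e*Π) (*-monoˡ-∣ (product qs) q∣e)
  where
  q∣e : q ∣ e
  q∣e = coprime-divisor (prime∤⇒coprime q-prime (prime∤product q-prime qs-prime q∉qs))
                        (subst (q ∣_) (trans d≡e*Π (*-comm e (product qs))) q∣d)

rad-∣ : (∀ {q} → Prime q → q ∣ n → q ∣ d) → rad n ∣ d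
rad-∣ {n} prime∣n⇒∣d = product-∣ (primeDivisors-unique n)
  (All.tabulate (proj₁ ∘ ∈primeDivisors⇒prime∣ n))
  (All.tabulate (λ q∈ → let q-prime , q∣n = ∈primeDivisors⇒prime∣ n q∈ in prime∣n⇒∣d q-prime q∣n))

prime∣⇒∣rad : .{{NonZero n}} → Prime q → q ∣ n → q ∣ rad n
prime∣⇒∣rad q-prime q∣n = ∈⇒∣product (prime∣⇒∈primeDivisors q-prime q∣n)

rad-nonZero : ∀ n → NonZero (rad n)
rad-nonZero n = productOfPrimes≢0 (All.tabulate (proj₁ ∘ ∈primeDivisors⇒prime∣ n))

prime∣⇒≤rad : .{{NonZero n}} → Prime q → q ∣ n → q ≤ rad n
prime∣⇒≤rad {n} q-prime q∣n = ∣⇒≤ {{rad-nonZero n}} (prime∣⇒∣rad q-prime q∣n)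

rad[n^e]≤rad[n] : .{{NonZero n}} → ∀ e → rad (n ^ e) ≤ rad n
rad[n^e]≤rad[n] {n} e = ∣⇒≤ {{rad-nonZero n}}
  (rad-∣ (λ q-prime q∣n^e → prime∣⇒∣rad q-prime (prime∣^⇒∣ q-prime e q∣n^e)))

n^[p[p∸1]k]≡1[mod²] : Prime p → p ∤ n → ∀ k → n ^ (p * (p ∸ 1) * k) ≡ 1 [mod p * p ]
n^[p[p∸1]k]≡1[mod²] {p} {n} p-prime p∤n k =
  subst (λ c → c ≡ 1 [mod p * p ]) exponents (≡1[mod]-^-lift (≡1[mod]-^ (fermat-coprime p-prime p∤n) k))
  where
  open ≡-Reasoning
  exponents : ((n ^ (p ∸ 1)) ^ k) ^ p ≡ n ^ (p * (p ∸ 1) * k)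
  exponents = begin
    ((n ^ (p ∸ 1)) ^ k) ^ p  ≡⟨ cong (_^ p) (^-*-assoc n (p ∸ 1) k) ⟩
    (n ^ ((p ∸ 1) * k)) ^ p  ≡⟨ ^-*-assoc n ((p ∸ 1) * k) p ⟩
    n ^ ((p ∸ 1) * k * p)    ≡⟨ cong (n ^_) (*-comm ((p ∸ 1) * k) p) ⟩
    n ^ (p * ((p ∸ 1) * k))  ≡⟨ cong (n ^_) (*-assoc p (p ∸ 1) k) ⟨
    n ^ (p * (p ∸ 1) * k)    ∎

coprime-suc : ∀ n → Coprime n (suc n)
coprime-suc n {d} (d∣n , d∣1+n) = ∣1⇒≡1 (∣m+n∣m⇒∣n (subst (d ∣_) (+-comm 1 n) d∣1+n) d∣n)

≡1[mod²]⇒abcTriple : Prime p → rad c < p → 1 < c → c ≡ 1 [mod p * p ] → ABCTriple 1 (c ∸ 1) c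
≡1[mod²]⇒abcTriple p-prime rad[c]<p (s≤s ()) (zero , refl)
≡1[mod²]⇒abcTriple {p@(suc r)} p-prime rad[c]<p _ (suc w , refl) = record
  { a-pos      = z<s
  ; b-pos      = z<s
  ; c-pos      = z<s
  ; coprime-ab = 1-coprimeTo _
  ; coprime-ac = 1-coprimeTo _
  ; coprime-bc = coprime-suc b
  ; sum        = refl
  ; rad<c      = s≤s (≤-trans (∣⇒≤ (rad-∣ prime∣abc⇒∣D)) (<⇒≤ D<b))
  }
  where
  b wp D : ℕ
  b = suc w * (p * p)
  wp = suc w * p
  D = rad (suc b) * wp
  instance
    D-nonZero : NonZero D
    D-nonZero = m*n≢0 (rad (suc b)) wp {{rad-nonZero (suc b)}}
  b≡wp*p : 1 * b ≡ wp * p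
  b≡wp*p = trans (*-identityˡ b) (sym (*-assoc (suc w) p p))
  D<b : D < b
  D<b = subst (D <_) (reassoc (suc w) p) (*-monoˡ-< wp rad[c]<p)
    where
    reassoc : ∀ w p → p * (w * p) ≡ w * (p * p)
    reassoc = solve-∀
  prime∣abc⇒∣D : Prime q → q ∣ 1 * b * suc b → q ∣ D
  prime∣abc⇒∣D {q} q-prime q∣abc with euclidsLemma (1 * b) (suc b) q-prime q∣abc
  ... | inj₂ q∣c = ∣m⇒∣m*n wp (prime∣⇒∣rad q-prime q∣c)
  ... | inj₁ q∣b with euclidsLemma wp p q-prime (subst (q ∣_) b≡wp*p q∣b)
  ...   | inj₁ q∣wp = ∣n⇒∣m*n (rad (suc b)) q∣wp
  ...   | inj₂ q∣p rewrite prime∣prime⇒≡ q-prime p-prime q∣p = ∣n⇒∣m*n (rad (suc b)) (n∣m*n (suc w))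

corollary3p5 : (n p k : ℕ) → 1 < n → Prime p → 2 < p → rad n < p → 0 < k →
    ABCTriple 1 (n ^ (p * (p ∸ 1) * k) ∸ 1) (n ^ (p * (p ∸ 1) * k))
corollary3p5 n p k 1<n p-prime 2<p rad[n]<p 0<k =
  ≡1[mod²]⇒abcTriple p-prime rad[c]<p 1<c (n^[p[p∸1]k]≡1[mod²] p-prime p∤n k)
  where
  instance
    n-nonZero : NonZero n
    n-nonZero = >-nonZero (<-trans z<s 1<n)
  e : ℕ
  e = p * (p ∸ 1) * k
  p∤n : p ∤ n
  p∤n p∣n = <⇒≱ rad[n]<p (prime∣⇒≤rad p-prime p∣n)
  rad[c]<p : rad (n ^ e) < p
  rad[c]<p = ≤-<-trans (rad[n^e]≤rad[n] e) rad[n]<p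
  1<c : 1 < n ^ e
  1<c = ^-monoʳ-< n 1<n (*-mono-< (*-mono-< (<-trans z<s 2<p) (m<n⇒0<n∸m (<-trans (n<1+n 1) 2<p))) 0<k)
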